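{- Let $Y$ be a connected finite simple undirected graph with a cycle-edge $e=\{v,w\}$. Let $O\in\mathsf{Acyc}(Y)$ and let $\mathbf{c}=c_1c_2\cdots c_m$ be a click-sequence for $O$ that contains every vertex of $\mathcal{I}(O)$ at least once and has $c_1=v$. Then every vertex of $\mathcal{I}(O)$ appears in $\mathbf{c}$ before any vertex of $\mathcal{I}(O)$ appears for the second time.
   Context: $\mathsf{Acyc}(Y)$ is the set of acyclic orientations of $Y$. For $O\in\mathsf{Acyc}(Y)$, $i\le_O j$ means there is a directed path from $i$ to $j$ in $O$. $\mathcal{I}(O)$ is the set of vertices $c$ with $v\le_O c\le_O w$ (the vertices on directed paths from $v$ to $w$), with relations inherited from $O$, if $v\le_O w$, and is empty otherwise. A click on an acyclic orientation converts a source into a sink by reversing its incident edges. A click-sequence for $O$ is a sequence $c_1\cdots c_m$ of vertices such that each $c_i$ is a source of the orientation obtained from $O$ by successively clicking $c_1,\dots,c_{i-1}$; $\mathbf{c}(O)$ denotes the resulting orientation. -}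

module Defs where

open import Data.Nat using (ℕ; _≤_)
open import Data.Bool using (Bool; true; false; if_then_else_; _∨_; T)
open import Data.Fin using (Fin; _≟_)
open import Data.List using (List; []; _∷_; _++_; [_]; length)
open import Data.List.Relation.Unary.Linked using (Linked)
open import Data.List.Relation.Unary.Unique.Propositional using (Unique)
open import Data.Product using (Σ; _×_; ∃)
open import Data.Sum using (_⊎_)
open import Relation.Nullary using (¬_)
open import Relation.Nullary.Decidable using (⌊_⌋)
open import Relation.Binary.PropositionalEquality using (_≡_)
open import Relation.Binary.Construct.Closure.Transitive using (TransClosure)
open import Relation.Binary.Construct.Closure.ReflexiveTransitive using (Star)

record Graph (n : ℕ) : Set where
  field
    adj    : Fin n → Fin n → Bool
    sym    : ∀ i j → adj i j ≡ adj j i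
    irrefl : ∀ i → adj i i ≡ false
open Graph public

Edge : ∀ {n} → Graph n → Fin n → Fin n → Set
Edge Y i j = T (adj Y i j)

Connected : ∀ {n} → Graph n → Set
Connected {n} Y = ∀ (i j : Fin n) → Star (Edge Y) i j

-- {v,w} is a cycle-edge: it is an edge lying on a cycle of Y, i.e. there are
-- distinct vertices v, u₁, …, u_k, w (k ≥ 1) forming a path, closed up by {w,v}.
CycleEdge : ∀ {n} → Graph n → Fin n → Fin n → Set
CycleEdge {n} Y v w =
  Edge Y v w ×
  Σ (List (Fin n)) (λ us →
    (1 ≤ length us) × Unique (v ∷ us ++ [ w ]) × Linked (Edge Y) (v ∷ us ++ [ w ]))

-- An orientation is given by its arc relation: O i j = true means i → j.
Orientation : ℕ → Set
Orientation n = Fin n → Fin n → Bool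

Arc : ∀ {n} → Orientation n → Fin n → Fin n → Set
Arc O i j = T (O i j)

IsOrientationOf : ∀ {n} → Graph n → Orientation n → Set
IsOrientationOf {n} Y O =
  (∀ (i j : Fin n) → Arc O i j → Edge Y i j) ×
  (∀ (i j : Fin n) → Edge Y i j → Arc O i j ⊎ Arc O j i) ×
  (∀ (i j : Fin n) → Arc O i j → ¬ Arc O j i)

Acyclic : ∀ {n} → Orientation n → Set
Acyclic {n} O = ∀ (i : Fin n) → ¬ TransClosure (Arc O) i i

Acyc : ∀ {n} → Graph n → Orientation n → Set
Acyc Y O = IsOrientationOf Y O × Acyclic O

_≤[_]_ : ∀ {n} → Fin n → Orientation n → Fin n → Set
i ≤[ O ] j = Star (Arc O) i j

InI : ∀ {n} → Orientation n → Fin n → Fin n → Fin n → Set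
InI O v w c = (v ≤[ O ] c) × (c ≤[ O ] w)

IsSource : ∀ {n} → Orientation n → Fin n → Set
IsSource {n} O c = ∀ (j : Fin n) → ¬ Arc O j c

click : ∀ {n} → Orientation n → Fin n → Orientation n
click O c i j = if ⌊ i ≟ c ⌋ ∨ ⌊ j ≟ c ⌋ then O j i else O i j

data ClickSeq {n : ℕ} : Orientation n → List (Fin n) → Set where
  []  : ∀ {O} → ClickSeq O []
  _∷_ : ∀ {O c cs} → IsSource O c → ClickSeq (click O c) cs → ClickSeq O (c ∷ cs)

-- Let #x be the number of occurrences of x in a click-sequence. For an arc
-- a → b of O the clicks of a and b must alternate, starting with a, so
-- #b ≤ #a ≤ #b + 1. Hence # is antitone along directed paths and drops by at
-- most one across the arc v → w (v is a source, so {v,w} is oriented v → w).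
-- Count within the prefix c₁ ⋯ c_j ending at the second occurrence of some
-- x ∈ I(O): there #v ≥ #x ≥ 2, so #w ≥ 1, so #y ≥ 1 for every y ≤_O w.
module Submission where

open import Defs
open import Data.Nat using (ℕ)
open import Data.Fin using (Fin; _<_)
open import Data.List using (List; _∷_; length; lookup)
open import Data.List.Membership.Propositional using (_∈_)
open import Data.Product using (Σ; _×_)
open import Relation.Binary.PropositionalEquality using (_≡_)

open import Data.Nat using (zero; suc; z≤n; s≤s; s≤s⁻¹) renaming (_≤_ to _≤ℕ_)
open import Data.Nat.Properties using (≤-refl; ≤-trans; ≤-reflexive; n≤1+n)
open import Data.Fin as Fin using (zero; suc; toℕ)
open import Data.Fin.Properties using (≤∧≢⇒<)
open import Data.List using ([]; take)
open import Data.Product using (_,_; proj₁; proj₂)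
open import Data.Sum using (inj₁; inj₂)
open import Data.Empty using (⊥-elim)
open import Function using (_∘_)
open import Relation.Nullary using (yes; no; ¬_)
open import Relation.Binary.Definitions using (DecidableEquality)
open import Relation.Binary.PropositionalEquality using (refl; trans) renaming (sym to ≡-sym)
open import Relation.Binary.Construct.Closure.ReflexiveTransitive using (ε; _◅_)

module Occurrences {A : Set} (_≟_ : DecidableEquality A) where

  occ : A → List A → ℕ
  occ x [] = 0
  occ x (c ∷ cs) with c ≟ x
  ... | yes _ = suc (occ x cs)
  ... | no _ = occ x cs

  occ-∷-≡ : ∀ {x y} cs → x ≡ y → occ y (x ∷ cs) ≡ suc (occ y cs)
  occ-∷-≡ {x} {y} cs x≡y with x ≟ y
  ... | yes _ = refl
  ... | no x≢y = ⊥-elim (x≢y x≡y)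

  occ-∷-mono : ∀ x c cs → occ x cs ≤ℕ occ x (c ∷ cs)
  occ-∷-mono x c cs with c ≟ x
  ... | yes _ = n≤1+n _
  ... | no _ = ≤-refl

  -- take (suc (toℕ j)) xs is the prefix c₁ ⋯ c_j, ending with position j.

  occ-take-lookup : ∀ xs (j : Fin (length xs)) →
                    1 ≤ℕ occ (lookup xs j) (take (suc (toℕ j)) xs)
  occ-take-lookup (x ∷ xs) zero = ≤-reflexive (≡-sym (occ-∷-≡ [] refl))
  occ-take-lookup (x ∷ xs) (suc j) =
    ≤-trans (occ-take-lookup xs j) (occ-∷-mono _ x (take (suc (toℕ j)) xs))

  occ-take-repeated : ∀ xs (i j : Fin (length xs)) → i < j → lookup xs i ≡ lookup xs j →
                      2 ≤ℕ occ (lookup xs j) (take (suc (toℕ j)) xs)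
  occ-take-repeated (x ∷ xs) zero (suc j) _ x≡xⱼ =
    ≤-trans (s≤s (occ-take-lookup xs j))
            (≤-reflexive (≡-sym (occ-∷-≡ (take (suc (toℕ j)) xs) x≡xⱼ)))
  occ-take-repeated (x ∷ xs) (suc i) (suc j) (s≤s i<j) xᵢ≡xⱼ =
    ≤-trans (occ-take-repeated xs i j i<j xᵢ≡xⱼ) (occ-∷-mono _ x (take (suc (toℕ j)) xs))

  lookup-occ-take : ∀ xs (j : Fin (length xs)) y → 1 ≤ℕ occ y (take (suc (toℕ j)) xs) →
                    Σ (Fin (length xs)) (λ k → (k Fin.≤ j) × (lookup xs k ≡ y))
  lookup-occ-take (x ∷ xs) j y _ with x ≟ y
  ... | yes x≡y = zero , z≤n , x≡y
  lookup-occ-take (x ∷ xs) zero y y∈ | no x≢y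
    with () ← y∈
  lookup-occ-take (x ∷ xs) (suc j) y y∈ | no x≢y
    with k , k≤j , xₖ≡y ← lookup-occ-take xs j y y∈ =
    suc k , s≤s k≤j , xₖ≡y

  -- A repeated entry lets position j itself be replaced by the earlier i.
  lookup-occ-take-before : ∀ xs (i j : Fin (length xs)) → i < j → lookup xs i ≡ lookup xs j →
                           ∀ y → 1 ≤ℕ occ y (take (suc (toℕ j)) xs) →
                           Σ (Fin (length xs)) (λ k → (k < j) × (lookup xs k ≡ y))
  lookup-occ-take-before xs i j i<j xᵢ≡xⱼ y y∈
    with k , k≤j , xₖ≡y ← lookup-occ-take xs j y y∈
    with k Fin.≟ j
  ... | yes refl = i , i<j , trans xᵢ≡xⱼ xₖ≡y
  ... | no k≢j = k , ≤∧≢⇒< k≤j k≢j , xₖ≡y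

module _ {n : ℕ} where
  open Occurrences (Fin._≟_ {n}) public

module _ {n : ℕ} {O : Orientation n} where

  click-reverses : ∀ {a b} → Arc O a b → Arc (click O a) b a
  click-reverses {a} {b} a→b with b Fin.≟ a
  ... | yes _ = a→b
  ... | no _ with a Fin.≟ a
  ... | yes _ = a→b
  ... | no a≢a = ⊥-elim (a≢a refl)

  click-preserves : ∀ {a b c} → ¬ a ≡ c → ¬ b ≡ c → Arc O a b → Arc (click O c) a b
  click-preserves {a} {b} {c} a≢c b≢c a→b with a Fin.≟ c
  ... | yes a≡c = ⊥-elim (a≢c a≡c)
  ... | no _ with b Fin.≟ c
  ... | yes b≡c = ⊥-elim (b≢c b≡c)
  ... | no _ = a→b

  source-arc : ∀ {Y : Graph n} {v w} → IsOrientationOf Y O → IsSource O v →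
               Edge Y v w → Arc O v w
  source-arc {v = v} {w} (_ , oriented , _) v-source vw with oriented v w vw
  ... | inj₁ v→w = v→w
  ... | inj₂ w→v = ⊥-elim (v-source w w→v)

arc-occ-bounds : ∀ {n} {O : Orientation n} {cs a b} → Arc O a b → ClickSeq O cs →
                 (occ b cs ≤ℕ occ a cs) × (occ a cs ≤ℕ suc (occ b cs))
arc-occ-bounds _ [] = z≤n , z≤n
arc-occ-bounds {O = O} {c ∷ cs} {a} {b} a→b (c-source ∷ clicks) with c Fin.≟ b
... | yes refl = ⊥-elim (c-source a a→b)
... | no c≢b with c Fin.≟ a
... | yes refl =
  let (#a≤#b , #b≤1+#a) = arc-occ-bounds (click-reverses {O = O} {c} {b} a→b) clicks
  in  #b≤1+#a , s≤s #a≤#b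
... | no c≢a =
  arc-occ-bounds (click-preserves {O = O} {a} {b} {c} (c≢a ∘ ≡-sym) (c≢b ∘ ≡-sym) a→b) clicks

path-occ-antitone : ∀ {n} {O : Orientation n} {cs a b} → a ≤[ O ] b → ClickSeq O cs →
                    occ b cs ≤ℕ occ a cs
path-occ-antitone ε _ = ≤-refl
path-occ-antitone (a→c ◅ c≤b) clicks =
  ≤-trans (path-occ-antitone c≤b clicks) (proj₁ (arc-occ-bounds a→c clicks))

ClickSeq-take : ∀ {n} {O : Orientation n} {cs} k → ClickSeq O cs → ClickSeq O (take k cs)
ClickSeq-take zero _ = []
ClickSeq-take (suc k) [] = []
ClickSeq-take (suc k) (c-source ∷ clicks) = c-source ∷ ClickSeq-take k clicks

clicked-twice⇒below-clicked : ∀ {n} {O : Orientation n} {cs v w x y} → Arc O v w →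
                              ClickSeq O cs → v ≤[ O ] x → 2 ≤ℕ occ x cs → y ≤[ O ] w →
                              1 ≤ℕ occ y cs
clicked-twice⇒below-clicked {cs = cs} {w = w} v→w clicks v≤x x-twice y≤w =
  ≤-trans w-once (path-occ-antitone y≤w clicks)
  where
    w-once : 1 ≤ℕ occ w cs
    w-once = s≤s⁻¹ (≤-trans (≤-trans x-twice (path-occ-antitone v≤x clicks))
                            (proj₂ (arc-occ-bounds v→w clicks)))

proposition7 : ∀ {n : ℕ} (Y : Graph n) (v w : Fin n) → Connected Y → CycleEdge Y v w →
    (O : Orientation n) → Acyc Y O →
    (cs : List (Fin n)) → ClickSeq O (v ∷ cs) →
    (∀ x → InI O v w x → x ∈ (v ∷ cs)) →
    ∀ (i j : Fin (length (v ∷ cs))) → i < j →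
    lookup (v ∷ cs) i ≡ lookup (v ∷ cs) j → InI O v w (lookup (v ∷ cs) j) →
    ∀ y → InI O v w y → Σ (Fin (length (v ∷ cs))) (λ k → (k < j) × (lookup (v ∷ cs) k ≡ y))
proposition7 Y v w _ (vw , _) O (orientation , _) cs clicks@(v-source ∷ _) _
             i j i<j xᵢ≡xⱼ (v≤xⱼ , _) y (_ , y≤w) =
  lookup-occ-take-before (v ∷ cs) i j i<j xᵢ≡xⱼ y
    (clicked-twice⇒below-clicked (source-arc {Y = Y} orientation v-source vw)
      (ClickSeq-take (suc (toℕ j)) clicks) v≤xⱼ
      (occ-take-repeated (v ∷ cs) i j i<j xᵢ≡xⱼ) y≤w)
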